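{- A number $t\in\frac{m+n}{2}+\mathbb{Z}$ is critical if and only if $|t-\kappa|<L+\frac12$ and, in addition in the case $n\equiv m\equiv1\bmod 2$, $t$ satisfies the parity condition $t-\kappa'\in(2\mathbb{N}-\epsilon)\cup-(2\mathbb{N}-1-\epsilon)$, where $\epsilon\in\{0,1\}$ with $\epsilon\equiv\delta+\delta'\bmod2$.
   Context: For $N\ge1$ let $L_0^+(N)$ be the set of $(w,l)\in\mathbb{Z}\times\mathbb{Z}^N$ with $l_1>\dots>l_N$, $l_i+l_{N+1-i}=0$ and $w+l_i\equiv N+1\bmod2$ for all $i$. Fix $n,m\ge1$, $(w,l)\in L_0^+(n)$, $(w',l')\in L_0^+(m)$, $\delta,\delta'\in\{0,1\}$ (parameters of $\pi_\infty\cong J(-w,l)\otimes\mathrm{sgn}^\delta$ and $\sigma_\infty\cong J(-w',l')\otimes\mathrm{sgn}^{\delta'}$). In Knapp's notation for representations of the Weil group $W_{\mathbb{R}}$, $(l,t)$ ($l\ge1$ integer, $t\in\mathbb{C}$) is irreducible $2$-dimensional and $(\mathrm{sgn}^\epsilon,t)$ ($\epsilon\in\{0,1\}$) is $1$-dimensional, with $L(s,(l,t))=\Gamma_{\mathbb{C}}(s+t+\frac l2)$, $L(s,(\mathrm{sgn}^\epsilon,t))=\Gamma_{\mathbb{R}}(s+t+\epsilon)$, where $\Gamma_{\mathbb{R}}(s)=\pi^{ -s/2}\Gamma(s/2)$, $\Gamma_{\mathbb{C}}(s)=2(2\pi)^{ -s}\Gamma(s)$; the $L$-function of a semisimple representation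 is the product over irreducible constituents (tensor products decompose by $(l,t)\otimes(l',t')=(l+l',t+t')\oplus(|l-l'|,t+t')$ with $(0,t):=(\mathrm{sgn}^0,t)\oplus(\mathrm{sgn}^1,t)$, $(l,t)\otimes(\mathrm{sgn}^\epsilon,t')=(l,t+t')$, $(\mathrm{sgn}^\epsilon,t)\otimes(\mathrm{sgn}^{\epsilon'},t')=(\mathrm{sgn}^{\epsilon+\epsilon'},t+t')$). Let $\pi_\infty^W=\bigoplus_{i=1}^{\lfloor n/2\rfloor}(l_i,-w/2)$, plus $(\mathrm{sgn}^\delta,-w/2)$ if $n$ is odd; $\sigma_\infty^W$ analogously from $(w',l',\delta')$; $\tau=\pi_\infty^W\otimes\sigma_\infty^W$ and $\check\tau$ its contragredient. A number $t\in\frac{n+m}{2}+\mathbb{Z}$ is critical if neither $L(s,\tau)$ nor $L(1-s,\check\tau)$ has a pole at $s=t$. Put $\kappa=\frac12(w+w'+1)$, $\kappa'=\kappa-\frac12$, $L_0=\min\{|l_i-l'_j|: 1\le i\le n,1\le j\le m, \text{ with } i\ne\frac{n+1}{2}\text{ or } j\ne\frac{m+1}{2}\}$ and $L=L_0/2$. $\mathbb{N}=\{1,2,3,\dots\}$. -}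

module Defs where

open import Data.Nat as ℕ using (ℕ; zero; suc; ∣_-_∣)
open import Data.Integer as ℤ using (ℤ; +_; -_; _-_)
import Data.Integer.Divisibility as ℤd
open import Data.Bool using (Bool; true; false; _xor_)
open import Data.Fin as Fin using (Fin; toℕ; opposite)
open import Data.List using (List; []; _∷_; _++_; map; concatMap; filter; allFin)
open import Data.List.Relation.Unary.Any using (Any)
open import Data.Product using (Σ; ∃; _×_)
open import Data.Sum using (_⊎_)
open import Relation.Binary.PropositionalEquality using (_≡_; _≢_)
open import Relation.Nullary using (¬_)
open import Function.Bundles using (_⇔_)

-- CONVENTION: all half-integral quantities (t, the shift t of a Weil
-- representation, κ, κ') are stored DOUBLED as integers.
-- Signs sgn^ε with ε ∈ {0,1} are encoded by Bool (false = 0, true = 1).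

bit : Bool → ℤ
bit false = + 0
bit true  = + 1

-- Irreducible representations of W_ℝ in Knapp's notation.
--   two l T  stands for (l , T/2)        (2-dimensional, l ≥ 1)
--   one ε T  stands for (sgn^ε , T/2)    (1-dimensional)
data WIrr : Set where
  two : ℕ → ℤ → WIrr
  one : Bool → ℤ → WIrr

WRep : Set
WRep = List WIrr

-- (l , T/2), with the convention (0 , t) := (sgn^0 , t) ⊕ (sgn^1 , t)
mk2 : ℕ → ℤ → WRep
mk2 zero    T = one false T ∷ one true T ∷ []
mk2 (suc l) T = two (suc l) T ∷ []

_⊗ᵢ_ : WIrr → WIrr → WRep
two l T ⊗ᵢ two l' T' = mk2 (l ℕ.+ l') (T ℤ.+ T') ++ mk2 ∣ l - l' ∣ (T ℤ.+ T')
two l T ⊗ᵢ one e T'  = two l (T ℤ.+ T') ∷ []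
one e T ⊗ᵢ two l T'  = two l (T ℤ.+ T') ∷ []
one e T ⊗ᵢ one e' T' = one (e xor e') (T ℤ.+ T') ∷ []

_⊗_ : WRep → WRep → WRep
ρ ⊗ σ = concatMap (λ a → concatMap (λ b → a ⊗ᵢ b) σ) ρ

dualᵢ : WIrr → WIrr
dualᵢ (two l T) = two l (- T)
dualᵢ (one e T) = one e (- T)

dual : WRep → WRep
dual = map dualᵢ

-- Pole of the local L-factor of an irreducible at s = S/2.
--   L(s,(l,t)) = Γ_ℂ(s+t+l/2): pole iff s+t+l/2 ∈ {0,-1,-2,...}
--   L(s,(sgn^ε,t)) = Γ_ℝ(s+t+ε): pole iff s+t+ε ∈ {0,-2,-4,...}
-- (Γ has no zeros, so a product of Γ-factors has a pole iff a factor does.)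
HasPoleᵢ : WIrr → ℤ → Set
HasPoleᵢ (two l T) S = ∃ λ (k : ℕ) → S ℤ.+ T ℤ.+ + l ≡ - (+ (2 ℕ.* k))
HasPoleᵢ (one e T) S = ∃ λ (k : ℕ) → S ℤ.+ T ℤ.+ (+ 2 ℤ.* bit e) ≡ - (+ (4 ℕ.* k))

HasPole : WRep → ℤ → Set
HasPole ρ S = Any (λ a → HasPoleᵢ a S) ρ

-- (w,l) ∈ L_0^+(N); indices 1..N of the paper are Fin N = 0..N-1 here.
InL0+ : (N : ℕ) → ℤ → (Fin N → ℤ) → Set
InL0+ N w l =
  (∀ (i j : Fin N) → i Fin.< j → l j ℤ.< l i) ×
  (∀ (i : Fin N) → l i ℤ.+ l (opposite i) ≡ + 0) ×
  (∀ (i : Fin N) → (+ 2) ℤd.∣ (w ℤ.+ l i - + (suc N)))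

-- π_∞^W = ⊕_{i=1}^{⌊N/2⌋} (l_i , -w/2)  ⊕ (sgn^δ , -w/2) if N odd
oddPart : (N : ℕ) → Bool → ℤ → WRep
oddPart N δ w with N ℕ.% 2
... | 1 = one δ (- w) ∷ []
... | _ = []

piW : (N : ℕ) → ℤ → (Fin N → ℤ) → Bool → WRep
piW N w l δ =
  concatMap (λ i → mk2 ℤ.∣ l i ∣ (- w))
            (filter (λ i → toℕ i ℕ.<? N ℕ./ 2) (allFin N))
  ++ oddPart N δ w

-- t = T/2 is critical for τ: neither L(s,τ) nor L(1-s,τˇ) has a pole at s = t
Critical : WRep → ℤ → Set
Critical τ T = ¬ HasPole τ T × ¬ HasPole (dual τ) (+ 2 - T)

-- |t - κ| < L + 1/2, where L = L_0/2 and L_0 is the minimum of |l_i - l'_j|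
-- over pairs (i,j) with i ≠ (n+1)/2 or j ≠ (m+1)/2 (0-based: 2i+1 ≠ n ...).
-- Doubled: |T - (w+w'+1)| < L_0 + 1, i.e. ≤ |l_i - l'_j| for all such pairs
-- (vacuous, i.e. L = ∞, when there is no such pair).
RangeCond : (n m : ℕ) → ℤ → (Fin n → ℤ) → ℤ → (Fin m → ℤ) → ℤ → Set
RangeCond n m w l w' l' T =
  ∀ (i : Fin n) (j : Fin m) →
    (2 ℕ.* toℕ i ℕ.+ 1 ≢ n ⊎ 2 ℕ.* toℕ j ℕ.+ 1 ≢ m) →
    ℤ.∣ T - (w ℤ.+ w' ℤ.+ + 1) ∣ ℕ.< suc ℤ.∣ l i - l' j ∣

-- t - κ' ∈ (2ℕ - ε) ∪ -(2ℕ - 1 - ε), ℕ = {1,2,...}; doubled with κ' = (w+w')/2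
ParityCond : ℤ → ℤ → Bool → ℤ → Set
ParityCond w w' ε T =
  (∃ λ (k : ℕ) → T - (w ℤ.+ w') ≡ + 2 ℤ.* (+ 2 ℤ.* + suc k - bit ε)) ⊎
  (∃ λ (k : ℕ) → T - (w ℤ.+ w') ≡ - (+ 2 ℤ.* (+ 2 ℤ.* + suc k - + 1 - bit ε)))

{-# OPTIONS --safe #-}
module Submission where

-- With half-integers doubled, put Y = 2t + 2t_c for a constituent c of τ with shift t_c.
-- Then t is critical iff, for every c, the Γ-factor of c without its shift has no
-- pole at Y/2 or at (2 - Y)/2. The tensor product of the constituents (l_i, ·) and
-- (l'_j, ·) is (|l_i - l'_j|, ·) ⊕ (|l_i + l'_j|, ·), and l'_{m+1-j} = -l'_j, so the
-- two-dimensional constituents of τ are the (|l_i - l'_j|, ·) over all pairs (i, j)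
-- that are not both middle indices; for odd n and m there is one more constituent
-- sgn^(δ+δ'). The parity conditions of L_0^+ make Y + |l_i - l'_j| even, and then
-- Γ_ℂ has no pole at either point iff |Y - 1| ≤ |l_i - l'_j|: this is the range
-- condition. For sgn^ε, which of the two Γ_ℝ-factors has a pole is decided by the
-- sign of Y and its residue modulo 4, and this gives the parity condition.

open import Defs
open import Data.Bool using (Bool; true; false; _xor_)
open import Data.Empty using (⊥-elim)
open import Data.Fin as Fin using (Fin; toℕ; opposite; fromℕ<)
open import Data.Fin.Properties
  using (opposite-prop; opposite-involutive; toℕ<n; toℕ-injective; toℕ-fromℕ<; <-cmp)
open import Data.Integer as ℤ using (ℤ; +_; -_; _-_; -[1+_]; +[1+_]; ∣_∣; 0ℤ)
import Data.Integer.Divisibility as ℤd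
import Data.Integer.Divisibility.Signed as ℤs
import Data.Integer.Properties as ℤ
import Data.Integer.Tactic.RingSolver as ℤ-Solver
open import Data.List using (List; []; _∷_; concatMap; filter; allFin)
open import Data.List.Membership.Propositional using (_∈_)
open import Data.List.Membership.Propositional.Properties
  using (++-∈⇔; ∈-++⁻; ∈-++⁺ˡ; ∈-++⁺ʳ; >>=-∈↔; ∈-filter⁻; ∈-filter⁺; ∈-allFin)
import Data.List.Relation.Unary.All as All
open import Data.List.Relation.Unary.All.Properties using (¬Any⇒All¬; All¬⇒¬Any)
open import Data.List.Relation.Unary.Any using (Any; here; there)
import Data.List.Relation.Unary.Any.Properties as Any
open import Data.Nat as ℕ using (ℕ; zero; suc; _≤_; _<_)
open import Data.Nat.Divisibility as ℕd using (divides)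
open import Data.Nat.DivMod using (m*n/n≡m; m/n*n≤m; /-monoˡ-≤; [m+kn]%n≡m%n; m≡m%n+[m/n]*n)
import Data.Nat.Properties as ℕ
import Data.Nat.Tactic.RingSolver as ℕ-Solver
open import Data.Product using (∃; ∃₂; _×_; _,_; proj₁; proj₂)
open import Data.Product.Function.Dependent.Propositional using (congˡ)
open import Data.Product.Function.NonDependent.Propositional using (_×-⇔_)
open import Data.Sum as Sum using (_⊎_; inj₁; inj₂)
open import Data.Sum.Function.Propositional using (_⊎-⇔_)
open import Function.Base using (_∘_)
open import Function.Bundles using (_⇔_; mk⇔; Equivalence)
import Function.Properties.Equivalence as ⇔
open import Function.Properties.Inverse using (↔⇒⇔)
open import Function.Related.TypeIsomorphisms using (¬-cong-⇔)
open import Relation.Binary.Definitions using (tri<; tri≈; tri>)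
open import Relation.Binary.PropositionalEquality
open import Relation.Nullary using (¬_; yes; no)

open Equivalence using (to; from)

even⇒4k⊎2+4k : ∀ n → 2 ℕd.∣ n → ∃ λ k → n ≡ 4 ℕ.* k ⊎ n ≡ 2 ℕ.+ 4 ℕ.* k
even⇒4k⊎2+4k zero          _     = 0 , inj₁ refl
even⇒4k⊎2+4k (suc zero)    2∣1   with () ← ℕd.∣1⇒≡1 2∣1
even⇒4k⊎2+4k (suc (suc n)) 2∣2+n with even⇒4k⊎2+4k n (ℕd.∣m+n∣m⇒∣n 2∣2+n ℕd.∣-refl)
... | k , inj₁ refl = k , inj₂ refl
... | k , inj₂ refl = suc k , inj₁ (sym (ℕ.*-suc 4 k))

4k≢2+4j : ∀ k j → 4 ℕ.* k ≢ 2 ℕ.+ 4 ℕ.* j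
4k≢2+4j k j eq = ℕ.even≢odd k j (ℕ.*-cancelˡ-≡ _ _ 2 (trans (quadruple k) (trans eq (half-odd j))))
  where
  quadruple : ∀ k → 2 ℕ.* (2 ℕ.* k) ≡ 4 ℕ.* k
  quadruple = ℕ-Solver.solve-∀
  half-odd : ∀ j → 2 ℕ.+ 4 ℕ.* j ≡ 2 ℕ.* suc (2 ℕ.* j)
  half-odd = ℕ-Solver.solve-∀

-4k≢-[2+4j] : ∀ k j → - + (4 ℕ.* k) ≢ - + (2 ℕ.+ 4 ℕ.* j)
-4k≢-[2+4j] k j = 4k≢2+4j k j ∘ ℤ.+-injective ∘ ℤ.neg-injective

+[2+4k]≢+[4+4j] : ∀ k j → + (2 ℕ.+ 4 ℕ.* k) ≢ + (4 ℕ.+ 4 ℕ.* j)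
+[2+4k]≢+[4+4j] k j = 4k≢2+4j k j ∘ ℕ.suc-injective ∘ ℕ.suc-injective ∘ ℤ.+-injective

nonpos≢pos : ∀ a b → - + a ≢ + suc b
nonpos≢pos zero    b ()
nonpos≢pos (suc a) b ()

-i≡i⇒i≡0 : ∀ {i} → - i ≡ i → i ≡ 0ℤ
-i≡i⇒i≡0 {+ zero} _ = refl

≡⇔≡ : ∀ {x y x′ y′ : ℤ} → x - y ≡ x′ - y′ → (x ≡ y) ⇔ (x′ ≡ y′)
≡⇔≡ {x} {y} {x′} {y′} eq = mk⇔
  (λ x≡y → ℤ.i-j≡0⇒i≡j x′ y′ (trans (sym eq) (ℤ.i≡j⇒i-j≡0 x≡y)))
  (λ x′≡y′ → ℤ.i-j≡0⇒i≡j x y (trans eq (ℤ.i≡j⇒i-j≡0 x′≡y′)))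

∣m⊖n∣≡∣m-n∣ : ∀ m n → ∣ m ℤ.⊖ n ∣ ≡ ℕ.∣ m - n ∣
∣m⊖n∣≡∣m-n∣ zero    zero    = refl
∣m⊖n∣≡∣m-n∣ zero    (suc n) = refl
∣m⊖n∣≡∣m-n∣ (suc m) zero    = refl
∣m⊖n∣≡∣m-n∣ (suc m) (suc n) = trans (cong ∣_∣ (ℤ.[1+m]⊖[1+n]≡m⊖n m n)) (∣m⊖n∣≡∣m-n∣ m n)

∣i±j∣-cases : ∀ i j →
  (∣ i - j ∣ ≡ ∣ i ∣ ℕ.+ ∣ j ∣ × ∣ i ℤ.+ j ∣ ≡ ℕ.∣ ∣ i ∣ - ∣ j ∣ ∣) ⊎
  (∣ i - j ∣ ≡ ℕ.∣ ∣ i ∣ - ∣ j ∣ ∣ × ∣ i ℤ.+ j ∣ ≡ ∣ i ∣ ℕ.+ ∣ j ∣)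
∣i±j∣-cases (+ a)    (+ b)    = inj₂ (trans (cong ∣_∣ (ℤ.m-n≡m⊖n a b)) (∣m⊖n∣≡∣m-n∣ a b) , refl)
∣i±j∣-cases (+ a)    -[1+ b ] = inj₁ (refl , ∣m⊖n∣≡∣m-n∣ a (suc b))
∣i±j∣-cases -[1+ a ] (+ zero) = inj₁ (sym (ℕ.+-identityʳ (suc a)) , refl)
∣i±j∣-cases -[1+ a ] +[1+ b ] =
  inj₁ (cong suc (sym (ℕ.+-suc a b)) , trans (∣m⊖n∣≡∣m-n∣ (suc b) (suc a)) (ℕ.∣-∣-comm (suc b) (suc a)))
∣i±j∣-cases -[1+ a ] -[1+ b ] =
  inj₂ (trans (∣m⊖n∣≡∣m-n∣ (suc b) (suc a)) (ℕ.∣-∣-comm b a) , cong suc (sym (ℕ.+-suc a b)))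

2∣i+j⇒2∣i+∣j∣ : ∀ i j → (+ 2) ℤd.∣ (i ℤ.+ j) → (+ 2) ℤd.∣ (i ℤ.+ + ∣ j ∣)
2∣i+j⇒2∣i+∣j∣ i j 2∣i+j with ℤ.+∣i∣≡i⊎+∣i∣≡-i j
... | inj₁ +∣j∣≡j  rewrite +∣j∣≡j  = 2∣i+j
... | inj₂ +∣j∣≡-j rewrite +∣j∣≡-j =
  ℤs.∣⇒∣ᵤ (subst (ℤs._∣_ (+ 2)) (sym (lemma i j))
    (ℤs.∣m∣n⇒∣m-n (ℤs.∣ᵤ⇒∣ {i = i ℤ.+ j} 2∣i+j) (ℤs.∣m⇒∣m*n j ℤs.∣-refl)))
  where
  lemma : ∀ i j → i ℤ.+ - j ≡ i ℤ.+ j - + 2 ℤ.* j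
  lemma = ℤ-Solver.solve-∀

not-both-zero? : ∀ x y → (x ≢ 0ℤ ⊎ y ≢ 0ℤ) ⊎ (x ≡ 0ℤ × y ≡ 0ℤ)
not-both-zero? x y with x ℤ.≟ 0ℤ | y ℤ.≟ 0ℤ
... | yes x≡0 | yes y≡0 = inj₂ (x≡0 , y≡0)
... | no x≢0  | _       = inj₁ (inj₁ x≢0)
... | yes _   | no y≢0  = inj₁ (inj₂ y≢0)

-- Indices of Fin N, reflected by opposite

<half⇔ : ∀ m n → m < n ℕ./ 2 ⇔ suc m ℕ.* 2 ≤ n
<half⇔ m n = mk⇔
  (λ m<n/2 → ℕ.≤-trans (ℕ.*-monoˡ-≤ 2 m<n/2) (m/n*n≤m n 2))
  (λ le → subst (_≤ n ℕ./ 2) (m*n/n≡m (suc m) 2) (/-monoˡ-≤ 2 le))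

toℕ+suc[toℕ-opposite]≡n : ∀ {N} (i : Fin N) → toℕ i ℕ.+ suc (toℕ (opposite i)) ≡ N
toℕ+suc[toℕ-opposite]≡n i rewrite opposite-prop i =
  trans (ℕ.+-suc (toℕ i) _) (ℕ.m+[n∸m]≡n (toℕ<n i))

<half⇔<opposite : ∀ {N} (i : Fin N) → toℕ i < N ℕ./ 2 ⇔ i Fin.< opposite i
<half⇔<opposite {N} i = ⇔.trans (<half⇔ (toℕ i) N) (mk⇔
    (λ le → ℕ.s≤s⁻¹ (ℕ.+-cancelˡ-≤ (toℕ i) _ _
              (subst₂ _≤_ (double (toℕ i)) (sym (toℕ+suc[toℕ-opposite]≡n i)) le)))
    (λ lt → subst₂ _≤_ (sym (double (toℕ i))) (toℕ+suc[toℕ-opposite]≡n i)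
              (ℕ.+-monoʳ-≤ (toℕ i) (ℕ.s≤s lt))))
  where
  double : ∀ s → suc s ℕ.* 2 ≡ s ℕ.+ suc (suc s)
  double = ℕ-Solver.solve-∀

middle⇔≡opposite : ∀ {N} (i : Fin N) → (2 ℕ.* toℕ i ℕ.+ 1 ≡ N) ⇔ (i ≡ opposite i)
middle⇔≡opposite {N} i = mk⇔
  (λ eq → toℕ-injective (ℕ.suc-injective (ℕ.+-cancelˡ-≡ (toℕ i) _ _
            (trans (sym (double (toℕ i))) (trans eq (sym (toℕ+suc[toℕ-opposite]≡n i)))))))
  (λ eq → trans (double (toℕ i))
            (trans (cong (λ j → toℕ i ℕ.+ suc (toℕ j)) eq) (toℕ+suc[toℕ-opposite]≡n i)))
  where
  double : ∀ s → 2 ℕ.* s ℕ.+ 1 ≡ s ℕ.+ suc s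
  double = ℕ-Solver.solve-∀

middle⇒odd : ∀ {N} (i : Fin N) → 2 ℕ.* toℕ i ℕ.+ 1 ≡ N → N ℕ.% 2 ≡ 1
middle⇒odd i eq = trans (cong (ℕ._% 2) (trans (sym eq) (lemma (toℕ i)))) ([m+kn]%n≡m%n 1 (toℕ i) 2)
  where
  lemma : ∀ s → 2 ℕ.* s ℕ.+ 1 ≡ 1 ℕ.+ s ℕ.* 2
  lemma = ℕ-Solver.solve-∀

odd⇒middle : ∀ N → N ℕ.% 2 ≡ 1 → ∃ λ (i : Fin N) → 2 ℕ.* toℕ i ℕ.+ 1 ≡ N
odd⇒middle N odd = fromℕ< half<N , trans (cong (λ s → 2 ℕ.* s ℕ.+ 1) (toℕ-fromℕ< half<N)) 2half+1≡N
  where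
  2half+1≡N : 2 ℕ.* (N ℕ./ 2) ℕ.+ 1 ≡ N
  2half+1≡N = trans (lemma (N ℕ./ 2)) (sym (trans (m≡m%n+[m/n]*n N 2) (cong (ℕ._+ (N ℕ./ 2) ℕ.* 2) odd)))
    where
    lemma : ∀ h → 2 ℕ.* h ℕ.+ 1 ≡ 1 ℕ.+ h ℕ.* 2
    lemma = ℕ-Solver.solve-∀
  half<N : N ℕ./ 2 < N
  half<N = subst (N ℕ./ 2 <_) 2half+1≡N (ℕ.≤-trans (ℕ.m≤m+n _ _) (ℕ.≤-reflexive (lemma (N ℕ./ 2))))
    where
    lemma : ∀ h → suc h ℕ.+ h ≡ 2 ℕ.* h ℕ.+ 1
    lemma = ℕ-Solver.solve-∀

-- Poles of a single constituent

shift : WIrr → ℤ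
shift (two _ T) = T
shift (one _ T) = T

-- The factor of c with its shift removed has a pole at s = Y/2.
PoleAt : WIrr → ℤ → Set
PoleAt (two l _) Y = ∃ λ (k : ℕ) → Y ℤ.+ + l ≡ - (+ (2 ℕ.* k))
PoleAt (one ε _) Y = ∃ λ (k : ℕ) → Y ℤ.+ (+ 2 ℤ.* bit ε) ≡ - (+ (4 ℕ.* k))

CriticalAt : WIrr → ℤ → Set
CriticalAt c Y = ¬ PoleAt c Y × ¬ PoleAt c (+ 2 - Y)

[2-S]-T≡2-[S+T] : ∀ S T → + 2 - S ℤ.+ - T ≡ + 2 - (S ℤ.+ T)
[2-S]-T≡2-[S+T] = ℤ-Solver.solve-∀

no-poles⇔criticalAt : ∀ c S →
  (¬ HasPoleᵢ c S × ¬ HasPoleᵢ (dualᵢ c) (+ 2 - S)) ⇔ CriticalAt c (S ℤ.+ shift c)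
no-poles⇔criticalAt (two _ T) S rewrite [2-S]-T≡2-[S+T] S T = ⇔.refl
no-poles⇔criticalAt (one _ T) S rewrite [2-S]-T≡2-[S+T] S T = ⇔.refl

¬Any⇔∀∉ : ∀ {A : Set} {P : A → Set} {xs} → (¬ Any P xs) ⇔ (∀ {x} → x ∈ xs → ¬ P x)
¬Any⇔∀∉ {xs = xs} = mk⇔ (All.lookup ∘ ¬Any⇒All¬ xs) (All¬⇒¬Any ∘ All.tabulate)

critical⇔criticalAt : ∀ τ S → Critical τ S ⇔ (∀ {c} → c ∈ τ → CriticalAt c (S ℤ.+ shift c))
critical⇔criticalAt τ S = mk⇔
  (λ (no-pole , no-dual-pole) {c} c∈τ → to (no-poles⇔criticalAt c S)
     (to ¬Any⇔∀∉ no-pole c∈τ , to ¬Any⇔∀∉ (no-dual-pole ∘ Any.map⁺) c∈τ))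
  (λ crit → from ¬Any⇔∀∉ (λ {c} c∈τ → proj₁ (from (no-poles⇔criticalAt c S) (crit c∈τ))) ,
            from ¬Any⇔∀∉ (λ {c} c∈τ → proj₂ (from (no-poles⇔criticalAt c S) (crit c∈τ))) ∘ Any.map⁻)

poleAt-two⇒∣Y-1∣≡ : ∀ P Y k → Y ℤ.+ + P ≡ - + (2 ℕ.* k) → ∣ Y - + 1 ∣ ≡ suc (P ℕ.+ 2 ℕ.* k)
poleAt-two⇒∣Y-1∣≡ P Y k eq = cong ∣_∣ (begin
  Y - + 1                       ≡⟨ split Y (+ P) ⟩
  (Y ℤ.+ + P) - + P - + 1       ≡⟨ cong (λ z → z - + P - + 1) eq ⟩
  - + (2 ℕ.* k) - + P - + 1     ≡⟨ collect (+ P) (+ (2 ℕ.* k)) ⟩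
  - + suc (P ℕ.+ 2 ℕ.* k)       ∎)
  where
  open ≡-Reasoning
  split : ∀ Y P → Y - + 1 ≡ (Y ℤ.+ P) - P - + 1
  split = ℤ-Solver.solve-∀
  collect : ∀ P K → - K - P - + 1 ≡ - (+ 1 ℤ.+ (P ℤ.+ K))
  collect = ℤ-Solver.solve-∀

reflected-poleAt-two⇒∣Y-1∣≡ : ∀ P Y k → + 2 - Y ℤ.+ + P ≡ - + (2 ℕ.* k) →
  ∣ Y - + 1 ∣ ≡ suc (P ℕ.+ 2 ℕ.* k)
reflected-poleAt-two⇒∣Y-1∣≡ P Y k eq = begin
  ∣ Y - + 1 ∣               ≡⟨ ℤ.∣-i∣≡∣i∣ (Y - + 1) ⟨
  ∣ - (Y - + 1) ∣           ≡⟨ cong ∣_∣ (lemma Y) ⟩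
  ∣ + 2 - Y - + 1 ∣         ≡⟨ poleAt-two⇒∣Y-1∣≡ P (+ 2 - Y) k eq ⟩
  suc (P ℕ.+ 2 ℕ.* k)       ∎
  where
  open ≡-Reasoning
  lemma : ∀ Y → - (Y - + 1) ≡ + 2 - Y - + 1
  lemma = ℤ-Solver.solve-∀

P<∣Y-1∣⇒poleAt-two : ∀ P T Y → (+ 2) ℤd.∣ (Y ℤ.+ + P) → P < ∣ Y - + 1 ∣ →
  PoleAt (two P T) Y ⊎ PoleAt (two P T) (+ 2 - Y)
P<∣Y-1∣⇒poleAt-two P T Y =
  subst (λ Z → (+ 2) ℤd.∣ (Z ℤ.+ + P) → P < ∣ Y - + 1 ∣ → PoleAt (two P T) Z ⊎ PoleAt (two P T) (+ 2 - Z))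
    (lemma Y) (from-D (Y - + 1))
  where
  lemma : ∀ Y → Y - + 1 ℤ.+ + 1 ≡ Y
  lemma = ℤ-Solver.solve-∀
  above : ∀ P E → + 2 - (+ 1 ℤ.+ (P ℤ.+ E) ℤ.+ + 1) ℤ.+ P ≡ - E
  above = ℤ-Solver.solve-∀
  below : ∀ P E → - (+ 1 ℤ.+ (P ℤ.+ E)) ℤ.+ + 1 ℤ.+ P ≡ - E
  below = ℤ-Solver.solve-∀
  parity : ∀ P e → suc P ℕ.+ e ℕ.+ 1 ℕ.+ P ≡ 2 ℕ.* suc P ℕ.+ e
  parity = ℕ-Solver.solve-∀
  from-D : ∀ D → (+ 2) ℤd.∣ (D ℤ.+ + 1 ℤ.+ + P) → P < ∣ D ∣ →
    PoleAt (two P T) (D ℤ.+ + 1) ⊎ PoleAt (two P T) (+ 2 - (D ℤ.+ + 1))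
  from-D (+ d) 2∣ P<d with ℕ.m≤n⇒∃[o]m+o≡n P<d
  ... | e , refl with ℕd.∣m+n∣m⇒∣n (subst (2 ℕd.∣_) (parity P e) 2∣) (ℕd.m∣m*n (suc P))
  ... | divides q e≡q*2 =
    inj₂ (q , trans (above (+ P) (+ e)) (cong (λ x → - + x) (trans e≡q*2 (ℕ.*-comm q 2))))
  from-D -[1+ d ] 2∣ P≤d with ℕ.m≤n⇒∃[o]m+o≡n (ℕ.s≤s⁻¹ P≤d)
  ... | e , refl with subst (2 ℕd.∣_) (trans (cong ∣_∣ (below (+ P) (+ e))) (ℤ.∣-i∣≡∣i∣ (+ e))) 2∣
  ... | divides q e≡q*2 =
    inj₁ (q , trans (below (+ P) (+ e)) (cong (λ x → - + x) (trans e≡q*2 (ℕ.*-comm q 2))))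

criticalAt-two⇔ : ∀ P T Y → (+ 2) ℤd.∣ (Y ℤ.+ + P) → CriticalAt (two P T) Y ⇔ ∣ Y - + 1 ∣ ≤ P
criticalAt-two⇔ P T Y 2∣ = mk⇔
  (λ (no-pole , no-reflected-pole) →
     ℕ.≮⇒≥ (Sum.[ no-pole , no-reflected-pole ] ∘ P<∣Y-1∣⇒poleAt-two P T Y 2∣))
  (λ near → (λ (k , eq) → ℕ.≤⇒≯ near (P< {k} (poleAt-two⇒∣Y-1∣≡ P Y k eq))) ,
            (λ (k , eq) → ℕ.≤⇒≯ near (P< {k} (reflected-poleAt-two⇒∣Y-1∣≡ P Y k eq))))
  where
  P< : ∀ {k} → ∣ Y - + 1 ∣ ≡ suc (P ℕ.+ 2 ℕ.* k) → P < ∣ Y - + 1 ∣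
  P< {k} eq = subst (P <_) (sym eq) (ℕ.s≤s (ℕ.m≤m+n P (2 ℕ.* k)))

-- Γ_ℂ(s) = Γ_ℝ(s) Γ_ℝ(s + 1), so (0, t) = sgn^0 ⊕ sgn^1 has the poles of Γ_ℂ(s + t).
poleAt-duplication : ∀ T Y → PoleAt (two 0 T) Y ⇔ (PoleAt (one false T) Y ⊎ PoleAt (one true T) Y)
poleAt-duplication T Y = mk⇔ to′ from′
  where
  odd-half : ∀ j → (Y ℤ.+ + 2 ≡ - + (4 ℕ.* j)) ⇔ (Y ℤ.+ + 0 ≡ - + (2 ℕ.+ 4 ℕ.* j))
  odd-half j = ≡⇔≡ (lemma Y (+ (4 ℕ.* j)))
    where
    lemma : ∀ Y J → Y ℤ.+ + 2 - - J ≡ Y ℤ.+ + 0 - - (+ 2 ℤ.+ J)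
    lemma = ℤ-Solver.solve-∀
  to′ : PoleAt (two 0 T) Y → PoleAt (one false T) Y ⊎ PoleAt (one true T) Y
  to′ (k , eq) with even⇒4k⊎2+4k (2 ℕ.* k) (ℕd.m∣m*n k)
  ... | j , inj₁ 2k≡4j   = inj₁ (j , trans eq (cong (λ x → - + x) 2k≡4j))
  ... | j , inj₂ 2k≡2+4j = inj₂ (j , from (odd-half j) (trans eq (cong (λ x → - + x) 2k≡2+4j)))
  from′ : PoleAt (one false T) Y ⊎ PoleAt (one true T) Y → PoleAt (two 0 T) Y
  from′ (inj₁ (j , eq)) = 2 ℕ.* j , trans eq (cong (λ x → - + x) (lemma j))
    where
    lemma : ∀ j → 4 ℕ.* j ≡ 2 ℕ.* (2 ℕ.* j)
    lemma = ℕ-Solver.solve-∀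
  from′ (inj₂ (j , eq)) = suc (2 ℕ.* j) , trans (to (odd-half j) eq) (cong (λ x → - + x) (lemma j))
    where
    lemma : ∀ j → 2 ℕ.+ 4 ℕ.* j ≡ 2 ℕ.* suc (2 ℕ.* j)
    lemma = ℕ-Solver.solve-∀

criticalAt-mk2⇔ : ∀ P T Y → (∀ {c} → c ∈ mk2 P T → CriticalAt c Y) ⇔ CriticalAt (two P T) Y
criticalAt-mk2⇔ (suc P) T Y = mk⇔ (λ crit → crit (here refl)) λ { crit (here refl) → crit }
criticalAt-mk2⇔ zero T Y = mk⇔
  (λ crit →
    Sum.[ proj₁ (crit (here refl)) , proj₁ (crit (there (here refl))) ] ∘ to (poleAt-duplication T Y) ,
    Sum.[ proj₂ (crit (here refl)) , proj₂ (crit (there (here refl))) ] ∘ to (poleAt-duplication T (+ 2 - Y)))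
  λ { (no-pole , no-reflected-pole) (here refl) →
        no-pole ∘ from (poleAt-duplication T Y) ∘ inj₁ ,
        no-reflected-pole ∘ from (poleAt-duplication T (+ 2 - Y)) ∘ inj₁
    ; (no-pole , no-reflected-pole) (there (here refl)) →
        no-pole ∘ from (poleAt-duplication T Y) ∘ inj₂ ,
        no-reflected-pole ∘ from (poleAt-duplication T (+ 2 - Y)) ∘ inj₂ }

∈-mk2⇒shift≡ : ∀ {P T c} → c ∈ mk2 P T → shift c ≡ T
∈-mk2⇒shift≡ {suc P} (here refl)         = refl
∈-mk2⇒shift≡ {zero}  (here refl)         = refl
∈-mk2⇒shift≡ {zero}  (there (here refl)) = refl

-- One-dimensional constituents

ParityShift : Bool → ℤ → Set
ParityShift ε Y =
  (∃ λ (k : ℕ) → Y ≡ + 2 ℤ.* (+ 2 ℤ.* + suc k - bit ε)) ⊎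
  (∃ λ (k : ℕ) → Y ≡ - (+ 2 ℤ.* (+ 2 ℤ.* + suc k - + 1 - bit ε)))

data Mod4 : ℤ → Set where
  nonpos₀ : ∀ k → Mod4 (- + (4 ℕ.* k))
  pos₂    : ∀ k → Mod4 (+ (2 ℕ.+ 4 ℕ.* k))
  pos₀    : ∀ k → Mod4 (+ (4 ℕ.+ 4 ℕ.* k))
  neg₂    : ∀ k → Mod4 (- + (2 ℕ.+ 4 ℕ.* k))

mod4 : ∀ {Y} → (+ 2) ℤd.∣ Y → Mod4 Y
mod4 {+ n} 2∣n with even⇒4k⊎2+4k n 2∣n
... | zero  , inj₁ refl = nonpos₀ 0
... | suc k , inj₁ refl = subst (λ x → Mod4 (+ x)) (sym (ℕ.*-suc 4 k)) (pos₀ k)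
... | k     , inj₂ refl = pos₂ k
mod4 { -[1+ n ]} 2∣1+n with even⇒4k⊎2+4k (suc n) 2∣1+n
... | k , inj₁ eq = subst (λ x → Mod4 (- + x)) (sym eq) (nonpos₀ k)
... | k , inj₂ eq = subst (λ x → Mod4 (- + x)) (sym eq) (neg₂ k)

-- The poles of L(s), the poles of L(1 - s) and the parity condition, each with Y
-- isolated in a form that evaluates once Y is one of the Mod4 normal forms.
PoleForm ReflectedPoleForm ParityForm : Bool → ℤ → Set
PoleForm ε Y          = ∃ λ k → Y ≡ - (+ 2 ℤ.* bit ε ℤ.+ + (4 ℕ.* k))
ReflectedPoleForm ε Y = ∃ λ k → + 2 ℤ.+ + 2 ℤ.* bit ε ℤ.+ + (4 ℕ.* k) ≡ Y
ParityForm ε Y        = (∃ λ k → Y ≡ + 4 - + 2 ℤ.* bit ε ℤ.+ + (4 ℕ.* k)) ⊎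
                        (∃ λ k → Y ≡ - (+ 2 - + 2 ℤ.* bit ε ℤ.+ + (4 ℕ.* k)))

poleAt-one⇔ : ∀ ε T Y → PoleAt (one ε T) Y ⇔ PoleForm ε Y
poleAt-one⇔ ε T Y = congˡ (λ {k} → ≡⇔≡ (lemma Y (bit ε) (+ (4 ℕ.* k))))
  where
  lemma : ∀ Y b K → Y ℤ.+ + 2 ℤ.* b - - K ≡ Y - - (+ 2 ℤ.* b ℤ.+ K)
  lemma = ℤ-Solver.solve-∀

reflected-poleAt-one⇔ : ∀ ε T Y → PoleAt (one ε T) (+ 2 - Y) ⇔ ReflectedPoleForm ε Y
reflected-poleAt-one⇔ ε T Y = congˡ (λ {k} → ≡⇔≡ (lemma Y (bit ε) (+ (4 ℕ.* k))))
  where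
  lemma : ∀ Y b K → + 2 - Y ℤ.+ + 2 ℤ.* b - - K ≡ + 2 ℤ.+ + 2 ℤ.* b ℤ.+ K - Y
  lemma = ℤ-Solver.solve-∀

parityShift⇔ : ∀ ε Y → ParityShift ε Y ⇔ ParityForm ε Y
parityShift⇔ ε Y =
  congˡ (λ {k} → ≡⇔≡ (cong (λ z → Y - z)
    (trans (upper (+ k) (bit ε)) (cong (λ z → + 4 - + 2 ℤ.* bit ε ℤ.+ z) (sym (ℤ.pos-* 4 k)))))) ⊎-⇔
  congˡ (λ {k} → ≡⇔≡ (cong (λ z → Y - - z)
    (trans (lower (+ k) (bit ε)) (cong (λ z → + 2 - + 2 ℤ.* bit ε ℤ.+ z) (sym (ℤ.pos-* 4 k))))))
  where
  upper : ∀ K b → + 2 ℤ.* (+ 2 ℤ.* (+ 1 ℤ.+ K) - b) ≡ + 4 - + 2 ℤ.* b ℤ.+ + 4 ℤ.* K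
  upper = ℤ-Solver.solve-∀
  lower : ∀ K b → + 2 ℤ.* (+ 2 ℤ.* (+ 1 ℤ.+ K) - + 1 - b) ≡ + 2 - + 2 ℤ.* b ℤ.+ + 4 ℤ.* K
  lower = ℤ-Solver.solve-∀

-- For each ε, two of the four classes are poles and the other two form the parity condition.
parity-by-class : ∀ ε {Y} → Mod4 Y → (¬ PoleForm ε Y × ¬ ReflectedPoleForm ε Y) ⇔ ParityForm ε Y
parity-by-class false (nonpos₀ k) = mk⇔ (λ (no-pole , _) → ⊥-elim (no-pole (k , refl)))
  λ { (inj₁ (j , eq)) → ⊥-elim (nonpos≢pos _ _ eq) ; (inj₂ (j , eq)) → ⊥-elim (-4k≢-[2+4j] k j eq) }
parity-by-class false (pos₂ k) = mk⇔ (λ (_ , no-reflected-pole) → ⊥-elim (no-reflected-pole (k , refl)))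
  λ { (inj₁ (j , eq)) → ⊥-elim (+[2+4k]≢+[4+4j] k j eq) ; (inj₂ (j , eq)) → ⊥-elim (nonpos≢pos _ _ (sym eq)) }
parity-by-class false (pos₀ k) = mk⇔ (λ _ → inj₁ (k , refl))
  λ _ → (λ (j , eq) → nonpos≢pos _ _ (sym eq)) , (λ (j , eq) → +[2+4k]≢+[4+4j] j k eq)
parity-by-class false (neg₂ k) = mk⇔ (λ _ → inj₂ (k , refl))
  λ _ → (λ (j , eq) → -4k≢-[2+4j] j k (sym eq)) , (λ (j , eq) → nonpos≢pos _ _ (sym eq))
parity-by-class true (nonpos₀ k) = mk⇔ (λ _ → inj₂ (k , refl))
  λ _ → (λ (j , eq) → -4k≢-[2+4j] k j eq) , (λ (j , eq) → nonpos≢pos _ _ (sym eq))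
parity-by-class true (pos₂ k) = mk⇔ (λ _ → inj₁ (k , refl))
  λ _ → (λ (j , eq) → nonpos≢pos _ _ (sym eq)) , (λ (j , eq) → +[2+4k]≢+[4+4j] k j (sym eq))
parity-by-class true (pos₀ k) = mk⇔ (λ (_ , no-reflected-pole) → ⊥-elim (no-reflected-pole (k , refl)))
  λ { (inj₁ (j , eq)) → ⊥-elim (+[2+4k]≢+[4+4j] j k (sym eq)) ; (inj₂ (j , eq)) → ⊥-elim (nonpos≢pos _ _ (sym eq)) }
parity-by-class true (neg₂ k) = mk⇔ (λ (no-pole , _) → ⊥-elim (no-pole (k , refl)))
  λ { (inj₁ (j , eq)) → ⊥-elim (nonpos≢pos _ _ eq) ; (inj₂ (j , eq)) → ⊥-elim (-4k≢-[2+4j] j k (sym eq)) }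

criticalAt-one⇔ : ∀ ε T Y → (+ 2) ℤd.∣ Y → CriticalAt (one ε T) Y ⇔ ParityShift ε Y
criticalAt-one⇔ ε T Y 2∣Y =
  ⇔.trans (¬-cong-⇔ (poleAt-one⇔ ε T Y) ×-⇔ ¬-cong-⇔ (reflected-poleAt-one⇔ ε T Y))
    (⇔.trans (parity-by-class ε (mod4 2∣Y)) (⇔.sym (parityShift⇔ ε Y)))

constituent : Bool → ℤ → ℤ → WIrr
constituent δ T (+ zero) = one δ T
constituent δ T +[1+ p ] = two (suc p) T
constituent δ T -[1+ p ] = two (suc p) T

constituent-neg : ∀ {δ T} x → constituent δ T (- x) ≡ constituent δ T x
constituent-neg (+ zero) = refl
constituent-neg +[1+ p ] = refl
constituent-neg -[1+ p ] = refl

constituent-nonzero : ∀ {δ T} x → x ≢ 0ℤ → constituent δ T x ≡ two ∣ x ∣ T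
constituent-nonzero (+ zero) x≢0 = ⊥-elim (x≢0 refl)
constituent-nonzero +[1+ p ] _   = refl
constituent-nonzero -[1+ p ] _   = refl

mk2-nonzero : ∀ {T} x → x ≢ 0ℤ → mk2 ∣ x ∣ T ≡ (two ∣ x ∣ T ∷ [])
mk2-nonzero (+ zero) x≢0 = ⊥-elim (x≢0 refl)
mk2-nonzero +[1+ p ] _   = refl
mk2-nonzero -[1+ p ] _   = refl

mk2-constituent : ∀ {δ T} x → x ≢ 0ℤ → mk2 ∣ x ∣ T ≡ (constituent δ T x ∷ [])
mk2-constituent (+ zero) x≢0 = ⊥-elim (x≢0 refl)
mk2-constituent +[1+ p ] _   = refl
mk2-constituent -[1+ p ] _   = refl

⊗ᵢ-constituent⇔ : ∀ {δ δ′ T T′ c} x y → x ≢ 0ℤ ⊎ y ≢ 0ℤ →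
  c ∈ constituent δ T x ⊗ᵢ constituent δ′ T′ y ⇔
  (c ∈ mk2 (∣ x - y ∣) (T ℤ.+ T′) ⊎ c ∈ mk2 (∣ x ℤ.+ y ∣) (T ℤ.+ T′))
⊗ᵢ-constituent⇔ {δ} {δ′} {T} {T′} x y not-both-zero with x ℤ.≟ 0ℤ | y ℤ.≟ 0ℤ
... | yes refl | yes refl = ⊥-elim (Sum.[ (λ x≢0 → x≢0 refl) , (λ y≢0 → y≢0 refl) ] not-both-zero)
... | yes refl | no y≢0
  rewrite constituent-nonzero {δ′} {T′} y y≢0 | ℤ.+-identityˡ (- y) | ℤ.∣-i∣≡∣i∣ y | ℤ.+-identityˡ y
        | mk2-nonzero {T ℤ.+ T′} y y≢0
  = mk⇔ inj₁ Sum.reduce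
... | no x≢0 | yes refl
  rewrite constituent-nonzero {δ} {T} x x≢0 | ℤ.+-identityʳ x | mk2-nonzero {T ℤ.+ T′} x x≢0
  = mk⇔ inj₁ Sum.reduce
... | no x≢0 | no y≢0
  rewrite constituent-nonzero {δ} {T} x x≢0 | constituent-nonzero {δ′} {T′} y y≢0
  with ∣i±j∣-cases x y
... | inj₁ (∣x-y∣≡ , ∣x+y∣≡) rewrite ∣x-y∣≡ | ∣x+y∣≡ = ++-∈⇔
... | inj₂ (∣x-y∣≡ , ∣x+y∣≡) rewrite ∣x-y∣≡ | ∣x+y∣≡ = ⇔.trans ++-∈⇔ (mk⇔ Sum.swap Sum.swap)

∈-concatMap⇔ : ∀ {A B : Set} {f : A → List B} {xs y} → y ∈ concatMap f xs ⇔ ∃ λ x → x ∈ xs × y ∈ f x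
∈-concatMap⇔ = ⇔.sym (↔⇒⇔ >>=-∈↔)

∈-⊗⇔ : ∀ {ρ σ c} → c ∈ ρ ⊗ σ ⇔ ∃₂ λ a b → (a ∈ ρ × b ∈ σ) × c ∈ a ⊗ᵢ b
∈-⊗⇔ = mk⇔
  (λ c∈ → let a , a∈ρ , c∈a⊗σ = to ∈-concatMap⇔ c∈
              b , b∈σ , c∈a⊗b = to ∈-concatMap⇔ c∈a⊗σ
          in a , b , (a∈ρ , b∈σ) , c∈a⊗b)
  (λ (a , b , (a∈ρ , b∈σ) , c∈a⊗b) →
     from ∈-concatMap⇔ (a , a∈ρ , from ∈-concatMap⇔ (b , b∈σ , c∈a⊗b)))

∈-oddPart⇔ : ∀ {N δ w a} → a ∈ oddPart N δ w ⇔ (N ℕ.% 2 ≡ 1 × a ≡ one δ (- w))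
∈-oddPart⇔ {N} with N ℕ.% 2
... | 0           = mk⇔ (λ ()) (λ ())
... | 1           = mk⇔ (λ { (here eq) → refl , eq }) (λ (_ , eq) → here eq)
... | suc (suc _) = mk⇔ (λ ()) (λ ())

module WeightProperties {N w} {l : Fin N → ℤ} (L : InL0+ N w l) where

  l-opposite : ∀ i → l (opposite i) ≡ - l i
  l-opposite i = trans (lemma (l i) (l (opposite i)))
    (trans (cong (λ z → z - l i) (proj₁ (proj₂ L) i)) (ℤ.+-identityˡ (- l i)))
    where
    lemma : ∀ x y → y ≡ x ℤ.+ y - x
    lemma = ℤ-Solver.solve-∀

  <opposite⇒nonzero : ∀ {i} → i Fin.< opposite i → l i ≢ 0ℤ
  <opposite⇒nonzero {i} lt li≡0 = ℤ.<-irrefl refl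
    (subst₂ ℤ._<_ (trans (l-opposite i) (cong -_ li≡0)) li≡0 (proj₁ L i (opposite i) lt))

  zero⇔middle : ∀ i → l i ≡ 0ℤ ⇔ (2 ℕ.* toℕ i ℕ.+ 1 ≡ N)
  zero⇔middle i = mk⇔ to′ from′
    where
    from′ : 2 ℕ.* toℕ i ℕ.+ 1 ≡ N → l i ≡ 0ℤ
    from′ middle = -i≡i⇒i≡0 (trans (sym (l-opposite i)) (cong l (sym (to (middle⇔≡opposite i) middle))))
    to′ : l i ≡ 0ℤ → 2 ℕ.* toℕ i ℕ.+ 1 ≡ N
    to′ li≡0 with <-cmp i (opposite i)
    ... | tri< lt _ _ = ⊥-elim (<opposite⇒nonzero lt li≡0)
    ... | tri≈ _ eq _ = from (middle⇔≡opposite i) eq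
    ... | tri> _ _ gt = ⊥-elim (<opposite⇒nonzero (subst (opposite i Fin.<_) (sym (opposite-involutive i)) gt)
                                  (trans (l-opposite i) (cong -_ li≡0)))

  ∈-piW⇔ : ∀ {δ a} → a ∈ piW N w l δ ⇔ ∃ λ i → a ≡ constituent δ (- w) (l i)
  ∈-piW⇔ {δ} {a} = mk⇔ to′ from′
    where
    lowerIndices : List (Fin N)
    lowerIndices = filter (λ i → toℕ i ℕ.<? N ℕ./ 2) (allFin N)
    lowerPart : List WIrr
    lowerPart = concatMap (λ i → mk2 ∣ l i ∣ (- w)) lowerIndices
    to′ : a ∈ piW N w l δ → ∃ λ i → a ≡ constituent δ (- w) (l i)
    to′ a∈ with ∈-++⁻ lowerPart a∈
    ... | inj₁ a∈lower with to (∈-concatMap⇔ {xs = lowerIndices}) a∈lower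
    ...   | i , i∈ , a∈mk2
      with subst (a ∈_) (mk2-constituent (l i) (<opposite⇒nonzero (to (<half⇔<opposite i)
                 (proj₂ (∈-filter⁻ (λ i → toℕ i ℕ.<? N ℕ./ 2) {xs = allFin N} i∈))))) a∈mk2
    ...     | here a≡ = i , a≡
    to′ a∈ | inj₂ a∈odd with to (∈-oddPart⇔ {N}) a∈odd
    ... | odd , a≡ with odd⇒middle N odd
    ...   | i , middle = i , trans a≡ (cong (constituent δ (- w)) (sym (from (zero⇔middle i) middle)))
    lower∈ : ∀ {i} → i Fin.< opposite i → constituent δ (- w) (l i) ∈ piW N w l δ
    lower∈ {i} lt = ∈-++⁺ˡ (from ∈-concatMap⇔ (i ,
      ∈-filter⁺ (λ i → toℕ i ℕ.<? N ℕ./ 2) (∈-allFin i) (from (<half⇔<opposite i) lt) ,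
      subst (constituent δ (- w) (l i) ∈_) (sym (mk2-constituent (l i) (<opposite⇒nonzero lt))) (here refl)))
    from′ : (∃ λ i → a ≡ constituent δ (- w) (l i)) → a ∈ piW N w l δ
    from′ (i , refl) with <-cmp i (opposite i)
    ... | tri< lt _ _ = lower∈ lt
    ... | tri≈ _ eq _ = subst (_∈ piW N w l δ) (cong (constituent δ (- w)) (sym li≡0))
                          (∈-++⁺ʳ lowerPart (from (∈-oddPart⇔ {N}) (middle⇒odd i middle , refl)))
      where
      middle : 2 ℕ.* toℕ i ℕ.+ 1 ≡ N
      middle = from (middle⇔≡opposite i) eq
      li≡0 : l i ≡ 0ℤ
      li≡0 = from (zero⇔middle i) middle
    ... | tri> _ _ gt =
      subst (_∈ piW N w l δ) (trans (cong (constituent δ (- w)) (l-opposite i)) (constituent-neg (l i)))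
        (lower∈ (subst (opposite i Fin.<_) (sym (opposite-involutive i)) gt))

-- The tensor product τ = π^W ⊗ σ^W

module TensorProduct {n m w w′} {l : Fin n → ℤ} {l′ : Fin m → ℤ} (L : InL0+ n w l) (L′ : InL0+ m w′ l′)
                     (δ δ′ : Bool) (T : ℤ) (2∣T-n-m : (+ 2) ℤd.∣ (T - + (n ℕ.+ m))) where

  open WeightProperties {w = w} L using (zero⇔middle; ∈-piW⇔)
  open WeightProperties {w = w′} L′ using ()
    renaming (zero⇔middle to zero⇔middle′; ∈-piW⇔ to ∈-piW⇔′; l-opposite to l′-opposite)

  V : ℤ
  V = - w ℤ.+ - w′

  Y : ℤ
  Y = T ℤ.+ V

  ε : Bool
  ε = δ xor δ′

  τ : WRep
  τ = piW n w l δ ⊗ piW m w′ l′ δ′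

  2∣Y+∣l-l′∣ : ∀ i j → (+ 2) ℤd.∣ (Y ℤ.+ + ∣ l i - l′ j ∣)
  2∣Y+∣l-l′∣ i j = 2∣i+j⇒2∣i+∣j∣ Y (l i - l′ j) (ℤs.∣⇒∣ᵤ
    (subst (ℤs._∣_ (+ 2)) (sym (lemma T w w′ (+ n) (+ m) (l i) (l′ j)))
      (ℤs.∣m∣n⇒∣m+n (ℤs.∣m∣n⇒∣m-n (ℤs.∣m∣n⇒∣m-n 2∣T-n-m′ 2∣w+l) 2∣w′+l′)
                    (ℤs.∣m⇒∣m*n (l i - + 1) ℤs.∣-refl))))
    where
    2∣T-n-m′ : (+ 2) ℤs.∣ (T - + (n ℕ.+ m))
    2∣T-n-m′ = ℤs.∣ᵤ⇒∣ 2∣T-n-m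
    2∣w+l : (+ 2) ℤs.∣ (w ℤ.+ l i - + suc n)
    2∣w+l = ℤs.∣ᵤ⇒∣ (proj₂ (proj₂ L) i)
    2∣w′+l′ : (+ 2) ℤs.∣ (w′ ℤ.+ l′ j - + suc m)
    2∣w′+l′ = ℤs.∣ᵤ⇒∣ (proj₂ (proj₂ L′) j)
    lemma : ∀ T w w′ n m x y → T ℤ.+ (- w ℤ.+ - w′) ℤ.+ (x - y) ≡
      T - (n ℤ.+ m) - (w ℤ.+ x - (+ 1 ℤ.+ n)) - (w′ ℤ.+ y - (+ 1 ℤ.+ m)) ℤ.+ + 2 ℤ.* (x - + 1)
    lemma = ℤ-Solver.solve-∀

  ∈τ⇔ : ∀ {c} → c ∈ τ ⇔ ∃₂ λ i j → c ∈ constituent δ (- w) (l i) ⊗ᵢ constituent δ′ (- w′) (l′ j)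
  ∈τ⇔ = mk⇔
    (λ c∈τ → let a , b , (a∈ , b∈) , c∈a⊗b = to ∈-⊗⇔ c∈τ
                 i , a≡ = to ∈-piW⇔ a∈
                 j , b≡ = to ∈-piW⇔′ b∈
             in i , j , subst₂ (λ a b → _ ∈ a ⊗ᵢ b) a≡ b≡ c∈a⊗b)
    (λ (i , j , c∈) → from ∈-⊗⇔ (_ , _ , (from ∈-piW⇔ (i , refl) , from ∈-piW⇔′ (j , refl)) , c∈))

  middles : n ℕ.% 2 ≡ 1 → m ℕ.% 2 ≡ 1 → ∃₂ λ i j → l i ≡ 0ℤ × l′ j ≡ 0ℤ
  middles n-odd m-odd =
    let i , i-middle = odd⇒middle n n-odd
        j , j-middle = odd⇒middle m m-odd
    in i , j , from (zero⇔middle i) i-middle , from (zero⇔middle′ j) j-middle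

  TwoDimCritical : Set
  TwoDimCritical = ∀ i j → l i ≢ 0ℤ ⊎ l′ j ≢ 0ℤ → CriticalAt (two ∣ l i - l′ j ∣ V) Y

  OneDimCritical : Set
  OneDimCritical = n ℕ.% 2 ≡ 1 → m ℕ.% 2 ≡ 1 → CriticalAt (one ε V) Y

  allCriticalAt⇔ : (∀ {c} → c ∈ τ → CriticalAt c (T ℤ.+ shift c)) ⇔ (TwoDimCritical × OneDimCritical)
  allCriticalAt⇔ = mk⇔ to′ from′
    where
    to′ : (∀ {c} → c ∈ τ → CriticalAt c (T ℤ.+ shift c)) → TwoDimCritical × OneDimCritical
    to′ crit =
      (λ i j not-both-zero → to (criticalAt-mk2⇔ _ V Y) λ {c} c∈ →
         subst (λ t → CriticalAt c (T ℤ.+ t)) (∈-mk2⇒shift≡ c∈)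
           (crit (from ∈τ⇔ (i , j , from (⊗ᵢ-constituent⇔ (l i) (l′ j) not-both-zero) (inj₁ c∈))))) ,
      (λ n-odd m-odd → let i , j , li≡0 , l′j≡0 = middles n-odd m-odd in
         crit (from ∈τ⇔ (i , j , subst₂ (λ x y → one ε V ∈ constituent δ (- w) x ⊗ᵢ constituent δ′ (- w′) y)
           (sym li≡0) (sym l′j≡0) (here refl))))
    viaPair : TwoDimCritical → ∀ {c} i j → l i ≢ 0ℤ ⊎ l′ j ≢ 0ℤ → c ∈ mk2 ∣ l i - l′ j ∣ V →
              CriticalAt c (T ℤ.+ shift c)
    viaPair two-crit {c} i j not-both-zero c∈ = subst (λ t → CriticalAt c (T ℤ.+ t)) (sym (∈-mk2⇒shift≡ c∈))
      (from (criticalAt-mk2⇔ _ V Y) (two-crit i j not-both-zero) c∈)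
    from′ : TwoDimCritical × OneDimCritical → ∀ {c} → c ∈ τ → CriticalAt c (T ℤ.+ shift c)
    from′ (two-crit , one-crit) {c} c∈τ with to ∈τ⇔ c∈τ
    ... | i , j , c∈ with not-both-zero? (l i) (l′ j)
    ... | inj₂ (li≡0 , l′j≡0) rewrite li≡0 | l′j≡0 with c∈
    ...   | here refl = one-crit (middle⇒odd i (to (zero⇔middle i) li≡0))
                                 (middle⇒odd j (to (zero⇔middle′ j) l′j≡0))
    from′ (two-crit , one-crit) {c} c∈τ | i , j , c∈ | inj₁ not-both-zero
      with to (⊗ᵢ-constituent⇔ (l i) (l′ j) not-both-zero) c∈
    ... | inj₁ c∈mk2 = viaPair two-crit i j not-both-zero c∈mk2
    ... | inj₂ c∈mk2 = viaPair two-crit i (opposite j)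
      (Sum.map₂ (λ l′j≢0 → l′j≢0 ∘ ℤ.neg-injective ∘ trans (sym (l′-opposite j))) not-both-zero)
      (subst (λ x → c ∈ mk2 ∣ x ∣ V)
        (cong (λ y → l i ℤ.+ y) (trans (sym (ℤ.neg-involutive (l′ j))) (cong -_ (sym (l′-opposite j))))) c∈mk2)

  twoDimCritical⇔rangeCond : TwoDimCritical ⇔ RangeCond n m w l w′ l′ T
  twoDimCritical⇔rangeCond = mk⇔
    (λ crit i j not-middle → to (near⇔ i j) (crit i j (from (not-both-zero⇔not-middle i j) not-middle)))
    (λ range i j not-both-zero → from (near⇔ i j) (range i j (to (not-both-zero⇔not-middle i j) not-both-zero)))
    where
    not-both-zero⇔not-middle : ∀ i j →
      (l i ≢ 0ℤ ⊎ l′ j ≢ 0ℤ) ⇔ (2 ℕ.* toℕ i ℕ.+ 1 ≢ n ⊎ 2 ℕ.* toℕ j ℕ.+ 1 ≢ m)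
    not-both-zero⇔not-middle i j = ¬-cong-⇔ (zero⇔middle i) ⊎-⇔ ¬-cong-⇔ (zero⇔middle′ j)
    Y-1≡ : Y - + 1 ≡ T - (w ℤ.+ w′ ℤ.+ + 1)
    Y-1≡ = lemma T w w′
      where
      lemma : ∀ T w w′ → T ℤ.+ (- w ℤ.+ - w′) - + 1 ≡ T - (w ℤ.+ w′ ℤ.+ + 1)
      lemma = ℤ-Solver.solve-∀
    near⇔ : ∀ i j → CriticalAt (two ∣ l i - l′ j ∣ V) Y ⇔ ∣ T - (w ℤ.+ w′ ℤ.+ + 1) ∣ < suc ∣ l i - l′ j ∣
    near⇔ i j = ⇔.trans (criticalAt-two⇔ _ V Y (2∣Y+∣l-l′∣ i j))
      (mk⇔ (ℕ.s≤s ∘ subst (_≤ _) (cong ∣_∣ Y-1≡)) (subst (_≤ _) (cong ∣_∣ (sym Y-1≡)) ∘ ℕ.s≤s⁻¹))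

  oneDimCritical⇔parityCond : OneDimCritical ⇔ (n ℕ.% 2 ≡ 1 → m ℕ.% 2 ≡ 1 → ParityCond w w′ ε T)
  oneDimCritical⇔parityCond = mk⇔
    (λ crit n-odd m-odd → to (parity⇔ n-odd m-odd) (crit n-odd m-odd))
    (λ par n-odd m-odd → from (parity⇔ n-odd m-odd) (par n-odd m-odd))
    where
    Y≡ : Y ≡ T - (w ℤ.+ w′)
    Y≡ = lemma T w w′
      where
      lemma : ∀ T w w′ → T ℤ.+ (- w ℤ.+ - w′) ≡ T - (w ℤ.+ w′)
      lemma = ℤ-Solver.solve-∀
    2∣Y : n ℕ.% 2 ≡ 1 → m ℕ.% 2 ≡ 1 → (+ 2) ℤd.∣ Y
    2∣Y n-odd m-odd = at (middles n-odd m-odd)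
      where
      at : (∃₂ λ i j → l i ≡ 0ℤ × l′ j ≡ 0ℤ) → (+ 2) ℤd.∣ Y
      at (i , j , li≡0 , l′j≡0) = subst (λ x → (+ 2) ℤd.∣ x)
        (trans (cong₂ (λ x y → Y ℤ.+ + ∣ x - y ∣) li≡0 l′j≡0) (ℤ.+-identityʳ Y)) (2∣Y+∣l-l′∣ i j)
    parity⇔ : n ℕ.% 2 ≡ 1 → m ℕ.% 2 ≡ 1 → CriticalAt (one ε V) Y ⇔ ParityCond w w′ ε T
    parity⇔ n-odd m-odd =
      subst (λ y → CriticalAt (one ε V) Y ⇔ ParityShift ε y) Y≡ (criticalAt-one⇔ ε V Y (2∣Y n-odd m-odd))

proposition2p1 : (n m : ℕ) → 1 ≤ n → 1 ≤ m →
    (w : ℤ) (l : Fin n → ℤ) (w' : ℤ) (l' : Fin m → ℤ) (δ δ' : Bool) →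
    InL0+ n w l → InL0+ m w' l' →
    (T : ℤ) → (+ 2) ℤd.∣ (T - + (n ℕ.+ m)) →
    Critical (piW n w l δ ⊗ piW m w' l' δ') T ⇔
      (RangeCond n m w l w' l' T ×
       (n ℕ.% 2 ≡ 1 → m ℕ.% 2 ≡ 1 → ParityCond w w' (δ xor δ') T))
proposition2p1 n m _ _ w l w′ l′ δ δ′ L L′ T 2∣T-n-m =
  ⇔.trans (critical⇔criticalAt τ T)
    (⇔.trans allCriticalAt⇔ (twoDimCritical⇔rangeCond ×-⇔ oneDimCritical⇔parityCond))
  where open TensorProduct {w = w} {w′ = w′} L L′ δ δ′ T 2∣T-n-m
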